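{- If $G$ is a randomly $k$-dimensional graph of order $n$, then $k\leq 3$ or $k\geq n-1$.
   Context: All graphs are finite, simple and connected. For an ordered set $W=\{w_1,\dots,w_k\}\subseteq V(G)$ and $v\in V(G)$, $r(v|W)=(d(v,w_1),\dots,d(v,w_k))$, where $d$ denotes graph distance. $W$ is a resolving set if distinct vertices have distinct representations with respect to $W$; a basis is a minimum-size resolving set and its size is the metric dimension $\beta(G)$. $G$ is randomly $k$-dimensional if $\beta(G)=k$ and every $k$-subset of $V(G)$ is a basis of $G$. -}

module Defs where

open import Data.Nat using (ℕ; zero; suc; _≤_)
open import Data.Fin using (Fin)
open import Data.Fin.Subset using (Subset; _∈_; ∣_∣)
open import Data.Product using (_×_; ∃)
open import Relation.Nullary using (¬_)
open import Relation.Binary.PropositionalEquality using (_≡_)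

record Graph (n : ℕ) : Set₁ where
  field
    Adj     : Fin n → Fin n → Set
    sym     : ∀ {u v} → Adj u v → Adj v u
    irrefl  : ∀ {u} → ¬ Adj u u
open Graph public

data Walk {n : ℕ} (G : Graph n) : Fin n → Fin n → ℕ → Set where
  here : ∀ {u} → Walk G u u zero
  step : ∀ {u v w ℓ} → Adj G u v → Walk G v w ℓ → Walk G u w (suc ℓ)

Connected : ∀ {n} → Graph n → Set
Connected G = ∀ u v → ∃ λ ℓ → Walk G u v ℓ

IsDist : ∀ {n} → Graph n → Fin n → Fin n → ℕ → Set
IsDist G u v d = Walk G u v d × (∀ m → Walk G u v m → d ≤ m)

SameRep : ∀ {n} → Graph n → Subset n → Fin n → Fin n → Set
SameRep G W u v = ∀ w → w ∈ W → ∀ d₁ d₂ → IsDist G u w d₁ → IsDist G v w d₂ → d₁ ≡ d₂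

Resolving : ∀ {n} → Graph n → Subset n → Set
Resolving G W = ∀ u v → SameRep G W u v → u ≡ v

MetricDim : ∀ {n} → Graph n → ℕ → Set
MetricDim G k = (∃ λ W → Resolving G W × ∣ W ∣ ≡ k)
              × (∀ W → Resolving G W → k ≤ ∣ W ∣)

RandomlyKDim : ∀ {n} → Graph n → ℕ → Set
RandomlyKDim G k = MetricDim G k × (∀ W → ∣ W ∣ ≡ k → Resolving G W)

module Submission where

-- Suppose instead 4 ≤ k ≤ n - 2 and write k = d + 4, n = d + N with N ≥ 6.
-- Fix the first d vertices D and let T range over the 3-subsets of the
-- remaining N vertices.  D ∪ T has only k - 1 elements, so it is not
-- resolving: some pair a < b of vertices outside D ∪ T has the same
-- representation (a vertex of a set is always resolved by that set).
-- Two different 3-sets T, T' cannot share such a pair: for w ∈ T' ∖ T the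
-- k-set D ∪ T ∪ {w} resolves every pair, but a and b agree at every vertex
-- of D ∪ T and at w ∈ T'.  Hence T ↦ (a , b) is injective, giving
-- C(N,3) ≤ C(N,2), which fails for N ≥ 6.
--
-- Distances exist only classically (adjacency is not decidable), so the
-- argument runs in the double-negation monad; this is harmless because the
-- contradiction is a negative statement.

open import Defs hiding (sym)
open import Data.Nat using (ℕ; zero; suc; _+_; _∸_; _≤_; _<_; z≤n; s≤s; _≤?_; _<?_)
open import Data.Nat.Properties
  using (≮⇒≥; ≰⇒>; +-cancelˡ-≤; +-mono-≤-<; +-mono-≤; ≤-reflexive; <⇒≱; +-assoc; +-comm; m≤m+n; m≤n⇒∃[o]m+o≡n; n≤1+n; <-irrefl; ≤-trans; ≤-refl; module ≤-Reasoning)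
open import Data.Nat.Induction using (<-rec)
open import Data.Nat.Combinatorics using (_C_; nC1≡n; nCk+nC[k+1]≡[n+1]C[k+1])
open import Data.Fin using (Fin; zero; suc; _↑ʳ_) renaming (_<_ to _<ᶠ_)
open import Data.Fin.Properties using (↑ʳ-injective; <-cmp) renaming (_≟_ to _≟ᶠ_; <-irrefl to <ᶠ-irrefl)
open import Data.Fin.Subset using (Subset; inside; outside; _∈_; _∉_; ∣_∣; _∪_; ⁅_⁆)
open import Data.Fin.Subset.Properties using (_∈?_; x∈p∪q⁻; x∈⁅y⁆⇒x≡y; ∪-identityʳ)
open import Data.Vec using ([]; _∷_; here; there)
open import Data.Vec.Properties using (∷-injectiveʳ)
open import Data.List using (List; []; _∷_; [_]; _++_; map; length; allFin)
open import Data.List.Properties using (length-++; length-map; length-tabulate; length-removeAt′)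
open import Data.List.Relation.Unary.All as All using (All; []; _∷_)
import Data.List.Relation.Unary.All.Properties as All
open import Data.List.Relation.Unary.Any as Any using (Any)
open import Data.List.Relation.Unary.Unique.Propositional using (Unique)
import Data.List.Relation.Unary.Unique.Propositional.Properties as Unique
open import Data.List.Relation.Unary.AllPairs using ([]; _∷_)
open import Data.List.Membership.Propositional using (_─_) renaming (_∈_ to _∈ˡ_)
open import Data.List.Membership.Propositional.Properties using (∈-map⁺; ∈-map⁻; ∈-++⁺ˡ; ∈-++⁺ʳ; ∈-allFin)
open import Data.Product using (Σ; ∃; ∃₂; _×_; _,_; proj₁; proj₂)
import Data.Product as Product
open import Data.Sum using (_⊎_; inj₁; inj₂)
import Data.Sum as Sum
open import Data.Empty using (⊥; ⊥-elim)
open import Level using (0ℓ)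
open import Relation.Binary using (tri<; tri≈; tri>)
open import Relation.Binary.PropositionalEquality using (_≡_; _≢_; refl; sym; trans; cong; cong₂; subst; subst₂; module ≡-Reasoning)
open import Relation.Nullary using (¬_; yes; no)
open import Relation.Nullary.Decidable using (decidable-stable; ¬¬-excluded-middle; from-yes)
open import Relation.Nullary.Negation using (¬¬-Monad; ¬¬-map; contradiction)

¬¬_ : Set → Set
¬¬ A = ¬ ¬ A

least : ∀ {P : ℕ → Set} ℓ → P ℓ → ¬¬ (∃ λ m → P m × (∀ j → P j → m ≤ j))
least {P} = <-rec (λ ℓ → P ℓ → ¬¬ Least) descend
  where
  Least : Set
  Least = ∃ λ m → P m × (∀ j → P j → m ≤ j)
  descend : ∀ ℓ → (∀ {j} → j < ℓ → P j → ¬¬ Least) → P ℓ → ¬¬ Least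
  descend ℓ below pℓ noLeast = ¬¬-excluded-middle {A = ∃ λ j → j < ℓ × P j} λ
    { (yes (j , j<ℓ , pj)) → below j<ℓ pj noLeast
    ; (no none) → noLeast (ℓ , pℓ , λ j pj → ≮⇒≥ λ j<ℓ → none (j , j<ℓ , pj)) }

module _ {n : ℕ} {G : Graph n} where

  distance-exists : Connected G → ∀ u v → ¬¬ (∃ λ δ → IsDist G u v δ)
  distance-exists conn u v = least (proj₁ (conn u v)) (proj₂ (conn u v))

  walk-length-zero : ∀ {u v} → Walk G u v 0 → u ≡ v
  walk-length-zero here = refl

  sameRep-sym : ∀ {W u v} → SameRep G W u v → SameRep G W v u
  sameRep-sym same w w∈W δ₁ δ₂ dist₁ dist₂ = sym (same w w∈W δ₂ δ₁ dist₂ dist₁)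

  -- A vertex of W is resolved by W from every other vertex (its distance to itself is 0).
  member-resolved : Connected G → ∀ {W w v} → w ∈ W → SameRep G W w v → w ≡ v
  member-resolved conn {W} {w} {v} w∈W same = decidable-stable (w ≟ᶠ v) λ w≢v →
    distance-exists conn v w λ { (δ , walk , shortest) →
      let 0≡δ = same w w∈W 0 δ (here , λ _ _ → z≤n) (walk , shortest)
      in w≢v (sym (walk-length-zero (subst (Walk G v w) (sym 0≡δ) walk))) }

  unresolved-pair : ∀ {W} → ¬ Resolving G W → ¬¬ (∃₂ λ u v → u ≢ v × SameRep G W u v)
  unresolved-pair notResolving noPair = notResolving λ u v same →
    decidable-stable (u ≟ᶠ v) λ u≢v → noPair (u , v , u≢v , same)

-- d ⊕ T : the first d vertices of Fin (d + N) together with the shifted copy of T.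
infixr 5 _⊕_
_⊕_ : ∀ d {N} → Subset N → Subset (d + N)
zero  ⊕ T = T
suc d ⊕ T = inside ∷ (d ⊕ T)

module _ {N : ℕ} where

  ∣⊕∣ : ∀ d (T : Subset N) → ∣ d ⊕ T ∣ ≡ d + ∣ T ∣
  ∣⊕∣ zero    T = refl
  ∣⊕∣ (suc d) T = cong suc (∣⊕∣ d T)

  ↑ʳ-∈⊕ : ∀ d {T : Subset N} {w} → w ∈ T → d ↑ʳ w ∈ d ⊕ T
  ↑ʳ-∈⊕ zero    w∈T = w∈T
  ↑ʳ-∈⊕ (suc d) w∈T = there (↑ʳ-∈⊕ d w∈T)

  ∉⊕ : ∀ d {T : Subset N} u → u ∉ d ⊕ T → ∃ λ a → u ≡ d ↑ʳ a
  ∉⊕ zero    u       _   = u , refl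
  ∉⊕ (suc d) zero    u∉  = contradiction here u∉
  ∉⊕ (suc d) (suc u) u∉  = Product.map₂ (cong suc) (∉⊕ d u (λ u∈ → u∉ (there u∈)))

  ∈⊕∪⁅⁆ : ∀ d {T : Subset N} {w} x → x ∈ d ⊕ (T ∪ ⁅ w ⁆) → x ∈ d ⊕ T ⊎ x ≡ d ↑ʳ w
  ∈⊕∪⁅⁆ zero {T} {w} x x∈ with x∈p∪q⁻ T ⁅ w ⁆ x∈
  ... | inj₁ x∈T  = inj₁ x∈T
  ... | inj₂ x∈⁅w⁆ = inj₂ (x∈⁅y⁆⇒x≡y w x∈⁅w⁆)
  ∈⊕∪⁅⁆ (suc d) zero    _         = inj₁ here
  ∈⊕∪⁅⁆ (suc d) (suc x) (there x∈) = Sum.map there (cong suc) (∈⊕∪⁅⁆ d x x∈)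

∣∪⁅⁆∣ : ∀ {N} (T : Subset N) w → w ∉ T → ∣ T ∪ ⁅ w ⁆ ∣ ≡ suc ∣ T ∣
∣∪⁅⁆∣ {suc N} (outside ∷ T) zero    _   = cong (λ S → suc ∣ S ∣) (∪-identityʳ T)
∣∪⁅⁆∣ (inside  ∷ T) zero    w∉T = contradiction here w∉T
∣∪⁅⁆∣ (outside ∷ T) (suc w) w∉T = ∣∪⁅⁆∣ T w (λ w∈ → w∉T (there w∈))
∣∪⁅⁆∣ (inside  ∷ T) (suc w) w∉T = cong suc (∣∪⁅⁆∣ T w (λ w∈ → w∉T (there w∈)))

new-element-∷ : ∀ {N} {A B : Subset N} {s t} → (∃ λ w → w ∈ B × w ∉ A) → ∃ λ w → w ∈ s ∷ B × w ∉ t ∷ A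
new-element-∷ (w , w∈B , w∉A) = suc w , there w∈B , λ { (there w∈A) → w∉A w∈A }

new-element : ∀ {N} (A B : Subset N) → ∣ A ∣ ≤ ∣ B ∣ → A ≢ B → ∃ λ w → w ∈ B × w ∉ A
new-element []            []            _             A≢B = contradiction refl A≢B
new-element (outside ∷ A) (inside  ∷ B) _             _   = zero , here , λ ()
new-element (inside  ∷ A) (inside  ∷ B) (s≤s |A|≤|B|) A≢B =
  new-element-∷ (new-element A B |A|≤|B| (λ A≡B → A≢B (cong (inside ∷_) A≡B)))
new-element (outside ∷ A) (outside ∷ B) |A|≤|B|       A≢B =
  new-element-∷ (new-element A B |A|≤|B| (λ A≡B → A≢B (cong (outside ∷_) A≡B)))
new-element (inside  ∷ A) (outside ∷ B) |A|<|B|       _   =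
  new-element-∷ (new-element A B (≤-trans (n≤1+n _) |A|<|B|) (λ { refl → <-irrefl refl |A|<|B| }))

subsets : ∀ N → ℕ → List (Subset N)
subsets zero    zero    = [ [] ]
subsets zero    (suc j) = []
subsets (suc N) zero    = map (outside ∷_) (subsets N zero)
subsets (suc N) (suc j) = map (inside ∷_) (subsets N j) ++ map (outside ∷_) (subsets N (suc j))

length-subsets : ∀ N j → length (subsets N j) ≡ N C j
length-subsets zero    zero    = refl
length-subsets zero    (suc j) = refl
length-subsets (suc N) zero    = trans (length-map _ (subsets N zero)) (length-subsets N zero)
length-subsets (suc N) (suc j) = begin
  length (map (inside ∷_) (subsets N j) ++ map (outside ∷_) (subsets N (suc j)))
    ≡⟨ length-++ (map (inside ∷_) (subsets N j)) ⟩
  length (map (inside ∷_) (subsets N j)) + length (map (outside ∷_) (subsets N (suc j)))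
    ≡⟨ cong₂ _+_ (length-map _ (subsets N j)) (length-map _ (subsets N (suc j))) ⟩
  length (subsets N j) + length (subsets N (suc j))
    ≡⟨ cong₂ _+_ (length-subsets N j) (length-subsets N (suc j)) ⟩
  N C j + N C suc j
    ≡⟨ nCk+nC[k+1]≡[n+1]C[k+1] N j ⟩
  suc N C suc j ∎
  where open ≡-Reasoning

subsets-size : ∀ N j → All (λ T → ∣ T ∣ ≡ j) (subsets N j)
subsets-size zero    zero    = refl ∷ []
subsets-size zero    (suc j) = []
subsets-size (suc N) zero    = All.map⁺ (subsets-size N zero)
subsets-size (suc N) (suc j) =
  All.++⁺ (All.map⁺ (All.map (cong suc) (subsets-size N j))) (All.map⁺ (subsets-size N (suc j)))

-- No subset is listed twice: the two halves differ in their first entry.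
subsets-unique : ∀ N j → Unique (subsets N j)
subsets-unique zero    zero    = [] ∷ []
subsets-unique zero    (suc j) = []
subsets-unique (suc N) zero    = Unique.map⁺ ∷-injectiveʳ (subsets-unique N zero)
subsets-unique (suc N) (suc j) =
  Unique.++⁺ (Unique.map⁺ ∷-injectiveʳ (subsets-unique N j))
             (Unique.map⁺ ∷-injectiveʳ (subsets-unique N (suc j)))
             heads-differ
  where
  heads-differ : ∀ {T} → T ∈ˡ map (inside ∷_) (subsets N j) × T ∈ˡ map (outside ∷_) (subsets N (suc j)) → ⊥
  heads-differ (T∈ , T∈′) with ∈-map⁻ (inside ∷_) T∈ | ∈-map⁻ (outside ∷_) T∈′
  ... | _ , _ , refl | _ , _ , ()

increasing-pairs : ∀ N → List (Fin N × Fin N)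
increasing-pairs zero    = []
increasing-pairs (suc N) =
  map (λ b → zero , suc b) (allFin N) ++ map (Product.map suc suc) (increasing-pairs N)

-- There are N C 2 of them: N pairs starting at zero, and the shifted rest.
length-increasing-pairs : ∀ N → length (increasing-pairs N) ≡ N C 2
length-increasing-pairs zero    = refl
length-increasing-pairs (suc N) = begin
  length (map (λ b → zero , suc b) (allFin N) ++ map (Product.map suc suc) (increasing-pairs N))
    ≡⟨ length-++ (map (λ b → zero , suc b) (allFin N)) ⟩
  length (map (λ b → zero , suc b) (allFin N)) + length (map (Product.map suc suc) (increasing-pairs N))
    ≡⟨ cong₂ _+_ (trans (length-map _ (allFin N)) (length-tabulate _)) (length-map _ (increasing-pairs N)) ⟩
  N + length (increasing-pairs N)
    ≡⟨ cong₂ _+_ (sym (nC1≡n N)) (length-increasing-pairs N) ⟩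
  N C 1 + N C 2
    ≡⟨ nCk+nC[k+1]≡[n+1]C[k+1] N 1 ⟩
  suc N C 2 ∎
  where open ≡-Reasoning

increasing-pairs-complete : ∀ {N} (a b : Fin N) → a <ᶠ b → (a , b) ∈ˡ increasing-pairs N
increasing-pairs-complete zero    (suc b) _         = ∈-++⁺ˡ (∈-map⁺ (λ b → zero , suc b) (∈-allFin b))
increasing-pairs-complete (suc a) (suc b) (s≤s a<b) =
  ∈-++⁺ʳ _ (∈-map⁺ (Product.map suc suc) (increasing-pairs-complete a b a<b))

∈-─ : ∀ {A : Set} {x y : A} {ys} (x∈ys : x ∈ˡ ys) → y ∈ˡ ys → x ≢ y → y ∈ˡ ys ─ x∈ys
∈-─ (Any.here refl) (Any.here refl) x≢y = contradiction refl x≢y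
∈-─ (Any.here _)    (Any.there y∈)  _   = y∈
∈-─ (Any.there _)   (Any.here y≡)   _   = Any.here y≡
∈-─ (Any.there x∈)  (Any.there y∈)  x≢y = Any.there (∈-─ x∈ y∈ x≢y)

unique-⊆-length : ∀ {A : Set} {xs ys : List A} → Unique xs → All (_∈ˡ ys) xs → length xs ≤ length ys
unique-⊆-length []              []            = z≤n
unique-⊆-length {xs = x ∷ xs} {ys} (x∉xs ∷ unique) (x∈ys ∷ xs⊆ys) = begin
  suc (length xs)          ≤⟨ s≤s (unique-⊆-length unique xs⊆ys─x) ⟩
  suc (length (ys ─ x∈ys)) ≡⟨ sym (length-removeAt′ ys (Any.index x∈ys)) ⟩
  length ys                ∎
  where
  open ≤-Reasoning
  xs⊆ys─x : All (_∈ˡ ys ─ x∈ys) xs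
  xs⊆ys─x = All.zipWith (λ (x≢z , z∈ys) → ∈-─ x∈ys z∈ys x≢z) (x∉xs , xs⊆ys)

injection-length : ∀ {A B : Set} {P : A → Set} (f : ∀ {x} → P x → B) →
                   (∀ {x y} (px : P x) (py : P y) → x ≢ y → f px ≢ f py) →
                   ∀ {xs ys} → (∀ {x} (px : P x) → f px ∈ˡ ys) → Unique xs → All P xs →
                   length xs ≤ length ys
injection-length {P = P} f f-injective {xs} {ys} f∈ys unique pxs =
  subst (_≤ length ys) (length-image pxs) (unique-⊆-length (image-unique unique pxs) (image-in pxs))
  where
  image : ∀ {zs} → All P zs → List _
  image = All.reduce f
  length-image : ∀ {zs} (pzs : All P zs) → length (image pzs) ≡ length zs
  length-image []         = refl
  length-image (_ ∷ pzs) = cong suc (length-image pzs)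
  image-in : ∀ {zs} (pzs : All P zs) → All (_∈ˡ ys) (image pzs)
  image-in []          = []
  image-in (pz ∷ pzs) = f∈ys pz ∷ image-in pzs
  image-fresh : ∀ {z zs} (pz : P z) → All (z ≢_) zs → (pzs : All P zs) → All (f pz ≢_) (image pzs)
  image-fresh pz []            []           = []
  image-fresh pz (z≢z′ ∷ z≢zs) (pz′ ∷ pzs) = f-injective pz pz′ z≢z′ ∷ image-fresh pz z≢zs pzs
  image-unique : ∀ {zs} → Unique zs → (pzs : All P zs) → Unique (image pzs)
  image-unique []               []          = []
  image-unique (z≢zs ∷ unique) (pz ∷ pzs) = image-fresh pz z≢zs pzs ∷ image-unique unique pzs

n≤nC2 : ∀ r → 3 + r ≤ (3 + r) C 2
n≤nC2 zero    = from-yes (3 ≤? 3 C 2)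
n≤nC2 (suc r) = begin
  4 + r                     ≡⟨ +-comm 1 (3 + r) ⟩
  (3 + r) + 1               ≤⟨ +-mono-≤ ≤-refl (≤-trans (s≤s z≤n) (n≤nC2 r)) ⟩
  (3 + r) + (3 + r) C 2     ≡⟨ cong (_+ (3 + r) C 2) (sym (nC1≡n (3 + r))) ⟩
  (3 + r) C 1 + (3 + r) C 2 ≡⟨ nCk+nC[k+1]≡[n+1]C[k+1] (3 + r) 1 ⟩
  (4 + r) C 2               ∎
  where open ≤-Reasoning

nC2<nC3 : ∀ {n} → 6 ≤ n → n C 2 < n C 3
nC2<nC3 6≤n with m≤n⇒∃[o]m+o≡n 6≤n
... | r , refl = from-6 r
  where
  from-6 : ∀ r → (6 + r) C 2 < (6 + r) C 3
  from-6 zero    = from-yes (6 C 2 <? 6 C 3)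
  from-6 (suc r) = begin-strict
    (7 + r) C 2               ≡⟨ sym (nCk+nC[k+1]≡[n+1]C[k+1] (6 + r) 1) ⟩
    (6 + r) C 1 + (6 + r) C 2 <⟨ +-mono-≤-< (≤-trans (≤-reflexive (nC1≡n (6 + r))) (n≤nC2 (3 + r))) (from-6 r) ⟩
    (6 + r) C 2 + (6 + r) C 3 ≡⟨ nCk+nC[k+1]≡[n+1]C[k+1] (6 + r) 2 ⟩
    (7 + r) C 3               ∎
    where open ≤-Reasoning

module LargeDimension {d N : ℕ} (G : Graph (d + N)) (conn : Connected G)
                      (random : RandomlyKDim G (d + 4)) where

  Confused : Subset N → Set
  Confused T = Σ (Fin N × Fin N) λ (a , b) → a <ᶠ b × SameRep G (d ⊕ T) (d ↑ʳ a) (d ↑ʳ b)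

  -- d ⊕ T has d + 3 < β(G) elements, so it leaves a pair unresolved; that
  -- pair avoids d ⊕ T, so it consists of two shifted vertices.
  triples-confused : ∀ T → ∣ T ∣ ≡ 3 → ¬¬ Confused T
  triples-confused T |T|≡3 notConfused = unresolved-pair too-small λ
    { (u , v , u≢v , same) → case-outside u v u≢v same }
    where
    too-small : ¬ Resolving G (d ⊕ T)
    too-small resolving with +-cancelˡ-≤ d 4 3 (subst (d + 4 ≤_) (trans (∣⊕∣ d T) (cong (d +_) |T|≡3))
                                                       (proj₂ (proj₁ random) (d ⊕ T) resolving))
    ... | s≤s (s≤s (s≤s ()))
    case-outside : ∀ u v → u ≢ v → SameRep G (d ⊕ T) u v → ⊥
    case-outside u v u≢v same with u ∈? d ⊕ T | v ∈? d ⊕ T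
    ... | yes u∈ | _     = u≢v (member-resolved conn u∈ same)
    ... | no _   | yes v∈ = u≢v (sym (member-resolved conn v∈ (sameRep-sym same)))
    ... | no u∉  | no v∉ with ∉⊕ d u u∉ | ∉⊕ d v v∉
    ... | a , refl | b , refl with <-cmp a b
    ...   | tri< a<b _ _ = notConfused ((a , b) , a<b , same)
    ...   | tri≈ _ a≡b _ = u≢v (cong (d ↑ʳ_) a≡b)
    ...   | tri> _ _ b<a = notConfused ((b , a) , b<a , sameRep-sym same)

  ConfusedTriple : Subset N → Set
  ConfusedTriple T = ∣ T ∣ ≡ 3 × Confused T

  pair : ∀ {T} → ConfusedTriple T → Fin N × Fin N
  pair (_ , ab , _) = ab

  -- Different triples are confused by different pairs: otherwise adding to
  -- d ⊕ T an element w of T′ ∖ T gives a (d + 4)-set, hence a resolving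
  -- set, that still does not resolve the common pair.
  pair-injective : ∀ {T T′} (c : ConfusedTriple T) (c′ : ConfusedTriple T′) → T ≢ T′ → pair c ≢ pair c′
  pair-injective {T} {T′} (|T|≡3 , (a , b) , a<b , same) (|T′|≡3 , _ , _ , same′) T≢T′ refl
    with new-element T T′ (≤-reflexive (trans |T|≡3 (sym |T′|≡3))) T≢T′
  ... | w , w∈T′ , w∉T = <ᶠ-irrefl (↑ʳ-injective d a b (resolving (d ↑ʳ a) (d ↑ʳ b) same-K)) a<b
    where
    K : Subset (d + N)
    K = d ⊕ (T ∪ ⁅ w ⁆)
    resolving : Resolving G K
    resolving = proj₂ random K (trans (∣⊕∣ d _) (cong (d +_) (trans (∣∪⁅⁆∣ T w w∉T) (cong suc |T|≡3))))
    same-K : SameRep G K (d ↑ʳ a) (d ↑ʳ b)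
    same-K x x∈K with ∈⊕∪⁅⁆ d x x∈K
    ... | inj₁ x∈d⊕T = same x x∈d⊕T
    ... | inj₂ refl  = same′ (d ↑ʳ w) (↑ʳ-∈⊕ d w∈T′)

  triples≤pairs : All ConfusedTriple (subsets N 3) → N C 3 ≤ N C 2
  triples≤pairs confusions =
    subst₂ _≤_ (length-subsets N 3) (length-increasing-pairs N)
      (injection-length pair pair-injective pair-increasing (subsets-unique N 3) confusions)
    where
    pair-increasing : ∀ {T} (c : ConfusedTriple T) → pair c ∈ˡ increasing-pairs N
    pair-increasing (_ , (a , b) , a<b , _) = increasing-pairs-complete a b a<b

  -- Choosing pairs is classical, which suffices since the goal is ⊥.
  impossible : 6 ≤ N → ⊥
  impossible 6≤N = all-triples-confused λ confusions → <⇒≱ (nC2<nC3 6≤N) (triples≤pairs confusions)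
    where
    all-triples-confused : ¬¬ All ConfusedTriple (subsets N 3)
    all-triples-confused = All.mapM 0ℓ ¬¬-Monad (λ {T} |T|≡3 → ¬¬-map (|T|≡3 ,_) (triples-confused T |T|≡3))
                                    (subsets-size N 3)

dimension-in-gap : ∀ {n k} (G : Graph n) → Connected G → RandomlyKDim G k → 4 ≤ k → 2 + k ≤ n → ⊥
dimension-in-gap G conn random 4≤k 2+k≤n
  with d , refl ← m≤n⇒∃[o]m+o≡n 4≤k
  with r , refl ← m≤n⇒∃[o]m+o≡n 2+k≤n
  = in-normal-form G (trans (sym (+-assoc d 6 r)) (cong (_+ r) (+-comm d 6))) (+-comm d 4) conn random
  where
  in-normal-form : ∀ {n k} (G : Graph n) → d + (6 + r) ≡ n → d + 4 ≡ k →
                   Connected G → RandomlyKDim G k → ⊥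
  in-normal-form G refl refl conn random = LargeDimension.impossible G conn random (m≤m+n 6 r)

two-below : ∀ {k} n → ¬ (n ∸ 1 ≤ k) → 2 + k ≤ n
two-below zero    n∸1≰k = contradiction z≤n n∸1≰k
two-below (suc n) n∸1≰k = s≤s (≰⇒> n∸1≰k)

mainTheorem4 : ∀ (n : ℕ) (G : Graph n) (k : ℕ) → Connected G → RandomlyKDim G k
    → k ≤ 3 ⊎ n ∸ 1 ≤ k
mainTheorem4 n G k conn random with k ≤? 3 | n ∸ 1 ≤? k
... | yes k≤3 | _           = inj₁ k≤3
... | no _    | yes n∸1≤k   = inj₂ n∸1≤k
... | no k≰3  | no n∸1≰k    = ⊥-elim (dimension-in-gap G conn random (≰⇒> k≰3) (two-below n n∸1≰k))
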